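{- Let $k\ge1$ and $h$ be integers with $\gcd(h,k)=1$. Then the set $\left\{m \in \mathbb{Z}+\frac{1}{2}: |m-\alpha_{H,K}|\leq \frac{1}{\gcd(k,6)}\right\}$ equals $\{\alpha_{H,K}, \alpha_{H,K}\pm 1\}$ if $\gcd(k,12)=1$; $\{\alpha_{H,K} \pm \frac{1}{2}\}$ if $\gcd(k,12)=2$; $\{\alpha_{H,K}\}$ if $\gcd(k,12) =4$; $\{\alpha_{H,K}+\frac{1}{\gcd(k,6)}\}$ if $\gcd(k,12) \in \{3,6\}$ and $h \equiv 1\pmod{3}$; $\{\alpha_{H,K}-\frac{1}{\gcd(k,6)}\}$ if $\gcd(k,12) \in \{3,6\}$ and $h \equiv 2\pmod{3}$; and $\emptyset$ if $\gcd(k,12)= 12$.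
   Context: $K:=\frac{k}{\gcd(k,6)}$, $H:=\frac{6h}{\gcd(k,6)}$, $\alpha_{H,K}:=\frac K2-\frac H6$. -}

module Defs where

open import Data.Nat as ℕ using (ℕ; NonZero)
open import Data.Nat.GCD using (gcd; gcd[m,n]≢0)
import Data.Nat.DivMod as ℕD
open import Data.Integer as ℤ using (ℤ; +_)
open import Data.Integer.DivMod as ℤD using ()
open import Data.Rational as ℚ using (ℚ; _+_; _-_; _≤_; ∣_∣)
open import Data.Product using (∃; _×_)
open import Data.Sum using (inj₂)
open import Relation.Binary.PropositionalEquality using (_≡_)

nz : ∀ k → NonZero (gcd k 6)
nz k = ℕ.≢-nonZero (gcd[m,n]≢0 k 6 (inj₂ λ ()))

g6 : ℕ → ℕ
g6 k = gcd k 6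

Kof : ℕ → ℕ
Kof k = ℕD._/_ k (gcd k 6) {{nz k}}

Hof : ℤ → ℕ → ℤ
Hof h k = ℤD._/ℕ_ (+ 6 ℤ.* h) (gcd k 6) {{nz k}}

α : ℤ → ℕ → ℚ
α h k = ((+ Kof k) ℚ./ 2) - (Hof h k ℚ./ 6)

invg : ℕ → ℚ
invg k = ℚ._/_ (+ 1) (gcd k 6) {{nz k}}

HalfInt : ℚ → Set
HalfInt m = ∃ λ (n : ℤ) → m ≡ ℚ._/_ n 1 + ℚ.½

InSet : ℤ → ℕ → ℚ → Set
InSet h k m = HalfInt m × (∣ m - α h k ∣ ≤ invg k)

-- With g = gcd(k,6) and D = 2g one has α = (k − 2h)/D, ½ = g/D and 1/g = 2/D, so the set
-- consists of the points α + e/D with |e| ≤ 2 and D ∣ k − 2h + e − g.  As D ∣ 12, this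
-- divisibility only depends on k and h modulo 12, and since gcd(h,k) = 1 the residues are not
-- both divisible by 2 or by 3; an exhaustive check over these residue pairs yields the
-- admissible offsets e, which depend only on gcd(k,12) and h mod 3.
module Submission where

open import Defs
open import Data.Nat using (ℕ; _≥_)
open import Data.Nat.GCD using (gcd)
open import Data.Integer as ℤ using (ℤ; +_)
open import Data.Integer.DivMod using (_%ℕ_)
open import Data.Integer.GCD as ℤG using ()
open import Data.Rational as ℚ using (ℚ; _+_; _-_; ½; 1ℚ)
open import Data.Sum using (_⊎_)
open import Data.Product using (_×_)
open import Data.Empty using (⊥)
open import Relation.Binary.PropositionalEquality using (_≡_)
open import Function.Bundles using (_⇔_)

open import Data.Integer using (-_; -[1+_])
open import Data.Integer.DivMod using (_/ℕ_; a≡a%ℕn+[a/ℕn]*n; n%ℕd<d)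
open import Data.Integer.Divisibility.Signed
  using (_∣_; _∣?_; divides; ∣⇒∣ᵤ; ∣ᵤ⇒∣; ∣-refl; ∣m+n∣n⇒∣m; ∣m∣n⇒∣m+n; ∣m⇒∣m*n; ∣n⇒∣m*n)
import Data.Integer.Properties as ℤP
open import Data.Integer.Tactic.RingSolver using (solve-∀)
open import Data.List using (List; []; _∷_; map)
open import Data.List.Membership.DecPropositional ℤ._≟_ using (_∈?_)
open import Data.List.Membership.Propositional using (_∈_)
open import Data.List.Membership.Propositional.Properties using (∈-map⁺; ∈-map⁻)
open import Data.List.Relation.Unary.All as All using (All)
open import Data.List.Relation.Unary.Any using (here; there)
open import Data.Nat as ℕ using (suc; NonZero; z≤n; s≤s)
open import Data.Nat.DivMod using (m/n*n≡m)
import Data.Nat.Divisibility as ℕ∣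
open import Data.Nat.GCD using (gcd[m,n]∣m; gcd[m,n]∣n; gcd-greatest; gcd-universality; gcd-assoc)
import Data.Nat.Properties as ℕP
import Data.Nat.Tactic.RingSolver as ℕRing
open import Data.Product using (_,_; ∃-syntax)
import Data.Rational.Properties as ℚP
open import Algebra.Properties.AbelianGroup ℚP.+-0-abelianGroup using (xyx⁻¹≈y)
open import Data.Rational.Unnormalised as ℚᵘ using (mkℚᵘ; *≡*; _≃_)
import Data.Rational.Unnormalised.Properties as ℚᵘP
open import Data.Sum using (inj₁; inj₂; [_,_]′)
open import Function.Bundles using (mk⇔; Equivalence)
open import Function.Construct.Composition using (_⇔-∘_)
open import Relation.Binary.PropositionalEquality
  using (refl; sym; trans; cong; cong₂; subst; subst₂; module ≡-Reasoning)
open import Relation.Nullary using (Dec; contradiction)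
open import Relation.Nullary.Decidable using (map′; _×-dec_; _→-dec_; toWitness)

toℚᵘ-/ : ∀ i n .{{_ : NonZero n}} → ℚ.toℚᵘ (i ℚ./ n) ≃ i ℚᵘ./ n
toℚᵘ-/ i (suc n) = ℚP.toℚᵘ-fromℚᵘ (mkℚᵘ i n)

*≡*⇒/≡/ : ∀ {i j m n} .{{_ : NonZero m}} .{{_ : NonZero n}} →
          i ℤ.* + n ≡ j ℤ.* + m → i ℚ./ m ≡ j ℚ./ n
*≡*⇒/≡/ {i} {j} {suc m} {suc n} eq = ℚP.fromℚᵘ-cong {mkℚᵘ i m} {mkℚᵘ j n} (*≡* eq)

/-distribʳ-+ : ∀ i j n .{{_ : NonZero n}} → (i ℤ.+ j) ℚ./ n ≡ i ℚ./ n + j ℚ./ n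
/-distribʳ-+ i j n = ℚP.toℚᵘ-injective (begin
  ℚ.toℚᵘ ((i ℤ.+ j) ℚ./ n)                 ≈⟨ toℚᵘ-/ (i ℤ.+ j) n ⟩
  (i ℤ.+ j) ℚᵘ./ n                        ≈⟨ same-denominator n ⟨
  i ℚᵘ./ n ℚᵘ.+ j ℚᵘ./ n                   ≈⟨ ℚᵘP.+-cong (toℚᵘ-/ i n) (toℚᵘ-/ j n) ⟨
  ℚ.toℚᵘ (i ℚ./ n) ℚᵘ.+ ℚ.toℚᵘ (j ℚ./ n)   ≈⟨ ℚP.toℚᵘ-homo-+ (i ℚ./ n) (j ℚ./ n) ⟨
  ℚ.toℚᵘ (i ℚ./ n + j ℚ./ n)               ∎)
  where
  open ℚᵘP.≃-Reasoning
  ring : ∀ i j n → (i ℤ.* n ℤ.+ j ℤ.* n) ℤ.* n ≡ (i ℤ.+ j) ℤ.* (n ℤ.* n)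
  ring = solve-∀
  same-denominator : ∀ n .{{_ : NonZero n}} → i ℚᵘ./ n ℚᵘ.+ j ℚᵘ./ n ≃ (i ℤ.+ j) ℚᵘ./ n
  same-denominator (suc n) = *≡* (ring i j (+ suc n))

neg-distribˡ-/ : ∀ i n .{{_ : NonZero n}} → (ℤ.- i) ℚ./ n ≡ ℚ.- (i ℚ./ n)
neg-distribˡ-/ i n@(suc _) = ℚP.toℚᵘ-injective (begin
  ℚ.toℚᵘ ((ℤ.- i) ℚ./ n)   ≈⟨ toℚᵘ-/ (ℤ.- i) n ⟩
  ℚᵘ.- (i ℚᵘ./ n)          ≈⟨ ℚᵘP.-‿cong (toℚᵘ-/ i n) ⟨
  ℚᵘ.- ℚ.toℚᵘ (i ℚ./ n)    ≈⟨ ℚP.toℚᵘ-homo‿- (i ℚ./ n) ⟨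
  ℚ.toℚᵘ (ℚ.- (i ℚ./ n))   ∎)
  where open ℚᵘP.≃-Reasoning

/-distribʳ-- : ∀ i j n .{{_ : NonZero n}} → (i ℤ.- j) ℚ./ n ≡ i ℚ./ n - j ℚ./ n
/-distribʳ-- i j n =
  trans (/-distribʳ-+ i (ℤ.- j) n) (cong (λ q → i ℚ./ n + q) (neg-distribˡ-/ j n))

∣-∣-/ : ∀ i n .{{_ : NonZero n}} → ℚ.∣ i ℚ./ n ∣ ≡ (+ ℤ.∣ i ∣) ℚ./ n
∣-∣-/ i n@(suc _) = ℚP.toℚᵘ-injective (begin
  ℚ.toℚᵘ ℚ.∣ i ℚ./ n ∣         ≈⟨ ℚP.toℚᵘ-homo-∣-∣ (i ℚ./ n) ⟩
  ℚᵘ.∣ ℚ.toℚᵘ (i ℚ./ n) ∣      ≈⟨ ℚᵘP.∣-∣-cong (toℚᵘ-/ i n) ⟩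
  ℚᵘ.∣ i ℚᵘ./ n ∣              ≈⟨ toℚᵘ-/ (+ ℤ.∣ i ∣) n ⟨
  ℚ.toℚᵘ ((+ ℤ.∣ i ∣) ℚ./ n)   ∎)
  where open ℚᵘP.≃-Reasoning

/-mono-≤ : ∀ {i j} n .{{_ : NonZero n}} → i ℤ.≤ j → i ℚ./ n ℚ.≤ j ℚ./ n
/-mono-≤ {i} {j} n@(suc _) i≤j = ℚP.toℚᵘ-cancel-≤
  (ℚᵘP.≤-respˡ-≃ (ℚᵘP.≃-sym (toℚᵘ-/ i n)) (ℚᵘP.≤-respʳ-≃ (ℚᵘP.≃-sym (toℚᵘ-/ j n))
    (ℚᵘ.*≤* (ℤP.*-monoʳ-≤-nonNeg (+ n) i≤j))))

/-cancel-≤ : ∀ {i j} n .{{_ : NonZero n}} → i ℚ./ n ℚ.≤ j ℚ./ n → i ℤ.≤ j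
/-cancel-≤ {i} {j} n@(suc _) i/n≤j/n = ℤP.*-cancelʳ-≤-pos i j (+ n) (ℚᵘP.drop-*≤*
  (ℚᵘP.≤-respˡ-≃ (toℚᵘ-/ i n) (ℚᵘP.≤-respʳ-≃ (toℚᵘ-/ j n) (ℚP.toℚᵘ-mono-≤ i/n≤j/n))))

∣i∣<d⇒d∣i⇒i≡0 : ∀ {d i} → ℤ.∣ i ∣ ℕ.< d → + d ∣ i → i ≡ + 0
∣i∣<d⇒d∣i⇒i≡0 {d} {i} ∣i∣<d d∣i with ℤ.∣ i ∣ in ∣i∣≡
... | 0     = ℤP.∣i∣≡0⇒i≡0 ∣i∣≡
... | suc _ = contradiction (subst (d ℕ∣.∣_) ∣i∣≡ (∣⇒∣ᵤ d∣i)) (ℕ∣.>⇒∤ ∣i∣<d)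

%ℕ-cong : ∀ {i j} d .{{_ : NonZero d}} → + d ∣ i ℤ.- j → i %ℕ d ≡ j %ℕ d
%ℕ-cong {i} {j} d d∣i-j = ℤP.+-injective (ℤP.i-j≡0⇒i≡j (+ x) (+ y) (∣i∣<d⇒d∣i⇒i≡0 ∣x-y∣<d d∣x-y))
  where
  x y : ℕ
  x = i %ℕ d
  y = j %ℕ d
  ∣x-y∣<d : ℤ.∣ + x ℤ.- + y ∣ ℕ.< d
  ∣x-y∣<d = subst (ℕ._< d) (cong ℤ.∣_∣ (sym (ℤP.[+m]-[+n]≡m⊖n x y)))
    (ℕP.≤-<-trans (ℤP.∣m⊝n∣≤m⊔n x y) (ℕP.⊔-pres-<m (n%ℕd<d i d) (n%ℕd<d j d)))
  split : ∀ x y p q d → (x ℤ.+ p ℤ.* d) ℤ.- (y ℤ.+ q ℤ.* d) ≡ (x ℤ.- y) ℤ.+ (p ℤ.- q) ℤ.* d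
  split = solve-∀
  i-j≡ : i ℤ.- j ≡ (+ x ℤ.- + y) ℤ.+ (i /ℕ d ℤ.- j /ℕ d) ℤ.* + d
  i-j≡ = trans (cong₂ ℤ._-_ (a≡a%ℕn+[a/ℕn]*n i d) (a≡a%ℕn+[a/ℕn]*n j d))
               (split (+ x) (+ y) (i /ℕ d) (j /ℕ d) (+ d))
  d∣x-y : + d ∣ + x ℤ.- + y
  d∣x-y = ∣m+n∣n⇒∣m (subst (+ d ∣_) i-j≡ d∣i-j) (∣n⇒∣m*n (i /ℕ d ℤ.- j /ℕ d) ∣-refl)

[i/ℕd]*d≡i : ∀ {i} d .{{_ : NonZero d}} → + d ∣ i → (i /ℕ d) ℤ.* + d ≡ i
[i/ℕd]*d≡i {i} d@(suc _) d∣i = begin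
  (i /ℕ d) ℤ.* + d                  ≡⟨ ℤP.+-identityˡ _ ⟨
  + 0 ℤ.+ (i /ℕ d) ℤ.* + d          ≡⟨ cong (λ x → + x ℤ.+ (i /ℕ d) ℤ.* + d) i%d≡0 ⟨
  + (i %ℕ d) ℤ.+ (i /ℕ d) ℤ.* + d   ≡⟨ a≡a%ℕn+[a/ℕn]*n i d ⟨
  i                                 ∎
  where
  open ≡-Reasoning
  i%d≡0 : i %ℕ d ≡ 0
  i%d≡0 = %ℕ-cong {i} {+ 0} d (subst (+ d ∣_) (sym (ℤP.+-identityʳ i)) d∣i)

[i%ℕn]%d≡i%ℕd : ∀ i {n d} .{{_ : NonZero n}} .{{_ : NonZero d}} → d ℕ∣.∣ n →
                (i %ℕ n) ℕ.% d ≡ i %ℕ d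
[i%ℕn]%d≡i%ℕd i {n} {d} d∣n = %ℕ-cong {+ (i %ℕ n)} {i} d
  (subst (+ d ∣_) (sym remainder-difference) (∣n⇒∣m*n (- (i /ℕ n)) (∣ᵤ⇒∣ {+ d} {+ n} d∣n)))
  where
  cancel : ∀ x q n → x ℤ.- (x ℤ.+ q ℤ.* n) ≡ - q ℤ.* n
  cancel = solve-∀
  remainder-difference : + (i %ℕ n) ℤ.- i ≡ - (i /ℕ n) ℤ.* + n
  remainder-difference = trans (cong (λ j → + (i %ℕ n) ℤ.- j) (a≡a%ℕn+[a/ℕn]*n i n))
                               (cancel (+ (i %ℕ n)) (i /ℕ n) (+ n))

∣m⇒∣n+m⇔∣n : ∀ {d m n} → d ∣ m → (d ∣ n ℤ.+ m ⇔ d ∣ n)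
∣m⇒∣n+m⇔∣n d∣m = mk⇔ (λ d∣n+m → ∣m+n∣n⇒∣m d∣n+m d∣m) (λ d∣n → ∣m∣n⇒∣m+n d∣n d∣m)

gcd[m%n,d]≡gcd[m,d] : ∀ m {n d} .{{_ : NonZero n}} → d ℕ∣.∣ n → gcd (m ℕ.% n) d ≡ gcd m d
gcd[m%n,d]≡gcd[m,d] m {n} {d} d∣n = gcd-universality
  (λ (c∣m , c∣d) → gcd-greatest (ℕ∣.%-presˡ-∣ c∣m (ℕ∣.∣-trans c∣d d∣n)) c∣d)
  (λ c∣g → let c∣d = ℕ∣.∣-trans c∣g (gcd[m,n]∣n (m ℕ.% n) d) in
    ℕ∣.∣n∣m%n⇒∣m (ℕ∣.∣-trans c∣d d∣n) (ℕ∣.∣-trans c∣g (gcd[m,n]∣m (m ℕ.% n) d)) , c∣d)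

coprime⇒residues-coprime : ∀ {h k} n .{{_ : NonZero n}} → ℤG.gcd h (+ k) ≡ + 1 →
                           gcd (k ℕ.% n) (gcd (h %ℕ n) n) ≡ 1
coprime⇒residues-coprime {h} {k} n coprime = ℕ∣.∣1⇒≡1
  (subst (d ℕ∣.∣_) (cong ℤ.∣_∣ coprime) (gcd-greatest d∣h (ℕ∣.∣n∣m%n⇒∣m d∣n d∣k%n)))
  where
  d : ℕ
  d = gcd (k ℕ.% n) (gcd (h %ℕ n) n)
  d∣k%n : d ℕ∣.∣ k ℕ.% n
  d∣k%n = gcd[m,n]∣m (k ℕ.% n) (gcd (h %ℕ n) n)
  d∣gcd : d ℕ∣.∣ gcd (h %ℕ n) n
  d∣gcd = gcd[m,n]∣n (k ℕ.% n) (gcd (h %ℕ n) n)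
  d∣n : d ℕ∣.∣ n
  d∣n = ℕ∣.∣-trans d∣gcd (gcd[m,n]∣n (h %ℕ n) n)
  d∣h%n : d ℕ∣.∣ h %ℕ n
  d∣h%n = ℕ∣.∣-trans d∣gcd (gcd[m,n]∣m (h %ℕ n) n)
  d∣h : d ℕ∣.∣ ℤ.∣ h ∣
  d∣h = ∣⇒∣ᵤ (subst (+ d ∣_) (sym (a≡a%ℕn+[a/ℕn]*n h n))
    (∣m∣n⇒∣m+n (∣ᵤ⇒∣ {+ d} {+ (h %ℕ n)} d∣h%n) (∣n⇒∣m*n (h /ℕ n) (∣ᵤ⇒∣ {+ d} {+ n} d∣n))))

module _ {a} {A : Set a} {v : A} where

  ∈[]⇔⊥ : v ∈ [] ⇔ ⊥
  ∈[]⇔⊥ = mk⇔ (λ ()) (λ ())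

  ∈[x]⇔≡ : ∀ {x} → v ∈ x ∷ [] ⇔ v ≡ x
  ∈[x]⇔≡ = mk⇔ (λ { (here v≡x) → v≡x ; (there ()) }) here

  ∈[x,y]⇔ : ∀ {x y} → v ∈ x ∷ y ∷ [] ⇔ (v ≡ x ⊎ v ≡ y)
  ∈[x,y]⇔ = mk⇔
    (λ { (here v≡x) → inj₁ v≡x ; (there (here v≡y)) → inj₂ v≡y ; (there (there ())) })
    [ here , (λ v≡y → there (here v≡y)) ]′

  ∈[x,y,z]⇔ : ∀ {x y z} → v ∈ x ∷ y ∷ z ∷ [] ⇔ (v ≡ x ⊎ v ≡ y ⊎ v ≡ z)
  ∈[x,y,z]⇔ = mk⇔
    (λ { (here v≡x) → inj₁ v≡x
       ; (there (here v≡y)) → inj₂ (inj₁ v≡y)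
       ; (there (there (here v≡z))) → inj₂ (inj₂ v≡z)
       ; (there (there (there ()))) })
    [ here , [ (λ v≡y → there (here v≡y)) , (λ v≡z → there (there (here v≡z))) ]′ ]′

_⇔?_ : ∀ {a b} {A : Set a} {B : Set b} → Dec A → Dec B → Dec (A ⇔ B)
a? ⇔? b? = map′ (λ (to , from) → mk⇔ to from) (λ A⇔B → Equivalence.to A⇔B , Equivalence.from A⇔B)
  ((a? →-dec b?) ×-dec (b? →-dec a?))

HalfIntegral : ℤ → ℕ → ℤ → Set
HalfIntegral h k e = + (2 ℕ.* g6 k) ∣ (+ k ℤ.- + 2 ℤ.* h) ℤ.+ e ℤ.- + g6 k

halfIntegral? : ∀ h k e → Dec (HalfIntegral h k e)
halfIntegral? h k e = _ ∣? _

window : List ℤ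
window = - + 2 ∷ - + 1 ∷ + 0 ∷ + 1 ∷ + 2 ∷ []

∣i∣≤2⇔i∈window : ∀ {i} → ℤ.∣ i ∣ ℕ.≤ 2 ⇔ i ∈ window
∣i∣≤2⇔i∈window = mk⇔ to from
  where
  to : ∀ {i} → ℤ.∣ i ∣ ℕ.≤ 2 → i ∈ window
  to { -[1+ 1 ] } _ = here refl
  to { -[1+ 0 ] } _ = there (here refl)
  to {+ 0}        _ = there (there (here refl))
  to {+ 1}        _ = there (there (there (here refl)))
  to {+ 2}        _ = there (there (there (there (here refl))))
  to { -[1+ suc (suc _) ] } (s≤s (s≤s ()))
  to {+ suc (suc (suc _))}  (s≤s (s≤s ()))
  from : ∀ {i} → i ∈ window → ℤ.∣ i ∣ ℕ.≤ 2
  from (here refl)                                 = ℕP.≤-refl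
  from (there (here refl))                         = s≤s z≤n
  from (there (there (here refl)))                 = z≤n
  from (there (there (there (here refl))))         = s≤s z≤n
  from (there (there (there (there (here refl))))) = ℕP.≤-refl

offsets : ℕ → ℕ → List ℤ
offsets 1 _ = + 0 ∷ + 2 ∷ - + 2 ∷ []
offsets 2 _ = + 2 ∷ - + 2 ∷ []
offsets 4 _ = + 0 ∷ []
offsets 3 1 = + 2 ∷ []
offsets 3 2 = - + 2 ∷ []
offsets 6 1 = + 2 ∷ []
offsets 6 2 = - + 2 ∷ []
offsets _ _ = []

offsets⊆window : ∀ c s {e} → e ∈ offsets c s → e ∈ window
offsets⊆window 1 _ (here refl)                 = there (there (here refl))
offsets⊆window 1 _ (there (here refl))         = there (there (there (there (here refl))))
offsets⊆window 1 _ (there (there (here refl))) = here refl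
offsets⊆window 2 _ (here refl)                 = there (there (there (there (here refl))))
offsets⊆window 2 _ (there (here refl))         = here refl
offsets⊆window 4 _ (here refl)                 = there (there (here refl))
offsets⊆window 3 1 (here refl)                 = there (there (there (there (here refl))))
offsets⊆window 3 2 (here refl)                 = here refl
offsets⊆window 6 1 (here refl)                 = there (there (there (there (here refl))))
offsets⊆window 6 2 (here refl)                 = here refl

OffsetsCorrect : ℕ → ℕ → Set
OffsetsCorrect σ ρ = All (λ e → HalfIntegral (+ σ) ρ e ⇔ e ∈ offsets (gcd ρ 12) (σ ℕ.% 3)) window

offsetsCorrect? : ∀ σ ρ → Dec (OffsetsCorrect σ ρ)
offsetsCorrect? σ ρ =
  All.all? (λ e → halfIntegral? (+ σ) ρ e ⇔? (e ∈? offsets (gcd ρ 12) (σ ℕ.% 3))) window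

offsets-correct : ∀ {σ} → σ ℕ.< 12 → ∀ {ρ} → ρ ℕ.< 12 → gcd ρ (gcd σ 12) ≡ 1 → OffsetsCorrect σ ρ
offsets-correct = toWitness {a? = ℕP.allUpTo? (λ σ → ℕP.allUpTo? (λ ρ →
  (gcd ρ (gcd σ 12) ℕP.≟ 1) →-dec offsetsCorrect? σ ρ) 12) 12} _

halfIntegral-mod12 : ∀ h k e → HalfIntegral h k e ⇔ HalfIntegral (+ (h %ℕ 12)) (k ℕ.% 12) e
halfIntegral-mod12 h k e =
  subst (λ g′ → HalfIntegral h k e ⇔ + (2 ℕ.* g′) ∣ r′ ℤ.+ e ℤ.- + g′) (sym g6[ρ]≡g)
    (subst (λ x → + D ∣ x ⇔ + D ∣ r′ ℤ.+ e ℤ.- + g) (sym shift) (∣m⇒∣n+m⇔∣n (∣n⇒∣m*n q D∣12)))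
  where
  σ ρ g D : ℕ
  σ = h %ℕ 12
  ρ = k ℕ.% 12
  g = g6 k
  D = 2 ℕ.* g
  r′ q : ℤ
  r′ = + ρ ℤ.- + 2 ℤ.* + σ
  q = + (k ℕ./ 12) ℤ.- + 2 ℤ.* (h /ℕ 12)
  g6[ρ]≡g : g6 ρ ≡ g
  g6[ρ]≡g = gcd[m%n,d]≡gcd[m,d] k (ℕ∣.divides 2 refl)
  D∣12 : + D ∣ + 12
  D∣12 = ∣ᵤ⇒∣ {+ D} {+ 12} (ℕ∣.*-monoʳ-∣ 2 (gcd[m,n]∣n k 6))
  regroup : ∀ ρ q σ p e g → ((ρ ℤ.+ q ℤ.* + 12) ℤ.- + 2 ℤ.* (σ ℤ.+ p ℤ.* + 12)) ℤ.+ e ℤ.- g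
                          ≡ ((ρ ℤ.- + 2 ℤ.* σ) ℤ.+ e ℤ.- g) ℤ.+ (q ℤ.- + 2 ℤ.* p) ℤ.* + 12
  regroup = solve-∀
  shift : (+ k ℤ.- + 2 ℤ.* h) ℤ.+ e ℤ.- + g ≡ (r′ ℤ.+ e ℤ.- + g) ℤ.+ q ℤ.* + 12
  shift = trans
    (cong₂ (λ x y → (x ℤ.- + 2 ℤ.* y) ℤ.+ e ℤ.- + g) (a≡a%ℕn+[a/ℕn]*n (+ k) 12) (a≡a%ℕn+[a/ℕn]*n h 12))
    (regroup (+ ρ) (+ (k ℕ./ 12)) (+ σ) (h /ℕ 12) e (+ g))

halfIntegral⇔offsets : ∀ {h k e} → ℤG.gcd h (+ k) ≡ + 1 → e ∈ window →
                       HalfIntegral h k e ⇔ e ∈ offsets (gcd k 12) (h %ℕ 3)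
halfIntegral⇔offsets {h} {k} {e} coprime e∈window =
  subst₂ (λ c s → HalfIntegral (+ (h %ℕ 12)) (k ℕ.% 12) e ⇔ e ∈ offsets c s)
    (gcd[m%n,d]≡gcd[m,d] k ℕ∣.∣-refl) ([i%ℕn]%d≡i%ℕd h (ℕ∣.divides 4 refl))
    (All.lookup (offsets-correct (n%ℕd<d h 12) (n%ℕd<d (+ k) 12)
                                 (coprime⇒residues-coprime {h} {k} 12 coprime)) e∈window)
  ⇔-∘ halfIntegral-mod12 h k e

module Offset (h : ℤ) (k : ℕ) where

  g D : ℕ
  g = g6 k
  D = 2 ℕ.* g

  instance
    g≢0 : NonZero g
    g≢0 = nz k
    D≢0 : NonZero D
    D≢0 = ℕP.m*n≢0 2 g

  infix 8 _/D
  _/D : ℤ → ℚ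
  i /D = i ℚ./ D

  r : ℤ
  r = + k ℤ.- + 2 ℤ.* h

  α≡r/D : α h k ≡ r /D
  α≡r/D = begin
    (+ Kof k) ℚ./ 2 - Hof h k ℚ./ 6   ≡⟨ cong₂ _-_ K/2≡k/D H/6≡2h/D ⟩
    (+ k) /D - (+ 2 ℤ.* h) /D         ≡⟨ /-distribʳ-- (+ k) (+ 2 ℤ.* h) D ⟨
    r /D                              ∎
    where
    open ≡-Reasoning
    ringℕ : ∀ a b → a ℕ.* (2 ℕ.* b) ≡ a ℕ.* b ℕ.* 2
    ringℕ = ℕRing.solve-∀
    ring₁ : ∀ x y → x ℤ.* (+ 2 ℤ.* y) ≡ + 2 ℤ.* (x ℤ.* y)
    ring₁ = solve-∀
    ring₂ : ∀ x → + 2 ℤ.* (+ 6 ℤ.* x) ≡ (+ 2 ℤ.* x) ℤ.* + 6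
    ring₂ = solve-∀
    K/2≡k/D : (+ Kof k) ℚ./ 2 ≡ (+ k) /D
    K/2≡k/D = *≡*⇒/≡/ {+ Kof k} {+ k} {2} {D} (begin
      + Kof k ℤ.* + D          ≡⟨ ℤP.pos-* (Kof k) D ⟨
      + (Kof k ℕ.* (2 ℕ.* g))  ≡⟨ cong +_ (ringℕ (Kof k) g) ⟩
      + (Kof k ℕ.* g ℕ.* 2)    ≡⟨ cong (λ n → + (n ℕ.* 2)) (m/n*n≡m (gcd[m,n]∣m k 6)) ⟩
      + (k ℕ.* 2)              ≡⟨ ℤP.pos-* k 2 ⟩
      + k ℤ.* + 2              ∎)
    H*g≡6h : Hof h k ℤ.* + g ≡ + 6 ℤ.* h
    H*g≡6h = [i/ℕd]*d≡i g (∣m⇒∣m*n h (∣ᵤ⇒∣ {+ g} {+ 6} (gcd[m,n]∣n k 6)))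
    H/6≡2h/D : Hof h k ℚ./ 6 ≡ (+ 2 ℤ.* h) /D
    H/6≡2h/D = *≡*⇒/≡/ {Hof h k} {+ 2 ℤ.* h} {6} {D} (begin
      Hof h k ℤ.* + D             ≡⟨ cong (Hof h k ℤ.*_) (ℤP.pos-* 2 g) ⟩
      Hof h k ℤ.* (+ 2 ℤ.* + g)   ≡⟨ ring₁ (Hof h k) (+ g) ⟩
      + 2 ℤ.* (Hof h k ℤ.* + g)   ≡⟨ cong (+ 2 ℤ.*_) H*g≡6h ⟩
      + 2 ℤ.* (+ 6 ℤ.* h)         ≡⟨ ring₂ h ⟩
      (+ 2 ℤ.* h) ℤ.* + 6         ∎)

  ½≡g/D : ½ ≡ (+ g) /D
  ½≡g/D = *≡*⇒/≡/ {+ 1} {+ g} {2} {D}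
    (trans (ℤP.*-identityˡ (+ D)) (trans (ℤP.pos-* 2 g) (ℤP.*-comm (+ 2) (+ g))))

  invg≡2/D : invg k ≡ (+ 2) /D
  invg≡2/D = *≡*⇒/≡/ {+ 1} {+ 2} {g} {D} (trans (ℤP.*-identityˡ (+ D)) (ℤP.pos-* 2 g))

  n/1≡nD/D : ∀ n → n ℚ./ 1 ≡ (n ℤ.* + D) /D
  n/1≡nD/D n = *≡*⇒/≡/ {n} {n ℤ.* + D} {1} {D} (sym (ℤP.*-identityʳ (n ℤ.* + D)))

  α+e/D≡[r+e]/D : ∀ e → α h k + e /D ≡ (r ℤ.+ e) /D
  α+e/D≡[r+e]/D e = trans (cong (λ a → a + e /D) α≡r/D) (sym (/-distribʳ-+ r e D))

  halfInt⇔ : ∀ m → HalfInt m ⇔ (∃[ e ] (HalfIntegral h k e × m ≡ α h k + e /D))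
  halfInt⇔ m = mk⇔ to from
    where
    open ≡-Reasoning
    n+½≡[nD+g]/D : ∀ n → n ℚ./ 1 + ½ ≡ (n ℤ.* + D ℤ.+ + g) /D
    n+½≡[nD+g]/D n =
      trans (cong₂ _+_ (n/1≡nD/D n) ½≡g/D) (sym (/-distribʳ-+ (n ℤ.* + D) (+ g) D))
    cancel : ∀ r x g → r ℤ.+ (x ℤ.+ g ℤ.- r) ℤ.- g ≡ x
    cancel = solve-∀
    r+[x-r]≡x : ∀ r x → r ℤ.+ (x ℤ.- r) ≡ x
    r+[x-r]≡x = solve-∀
    x≡[x-g]+g : ∀ x g → x ≡ (x ℤ.- g) ℤ.+ g
    x≡[x-g]+g = solve-∀
    to : HalfInt m → ∃[ e ] (HalfIntegral h k e × m ≡ α h k + e /D)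
    to (n , m≡n+½) = n ℤ.* + D ℤ.+ + g ℤ.- r , divides n (cancel r (n ℤ.* + D) (+ g)) , (begin
      m                                   ≡⟨ m≡n+½ ⟩
      n ℚ./ 1 + ½                         ≡⟨ n+½≡[nD+g]/D n ⟩
      (n ℤ.* + D ℤ.+ + g) /D              ≡⟨ cong _/D (r+[x-r]≡x r (n ℤ.* + D ℤ.+ + g)) ⟨
      (r ℤ.+ (n ℤ.* + D ℤ.+ + g ℤ.- r)) /D ≡⟨ α+e/D≡[r+e]/D (n ℤ.* + D ℤ.+ + g ℤ.- r) ⟨
      α h k + (n ℤ.* + D ℤ.+ + g ℤ.- r) /D ∎)
    from : ∃[ e ] (HalfIntegral h k e × m ≡ α h k + e /D) → HalfInt m
    from (e , divides n r+e-g≡nD , m≡) = n , (begin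
      m                        ≡⟨ m≡ ⟩
      α h k + e /D             ≡⟨ α+e/D≡[r+e]/D e ⟩
      (r ℤ.+ e) /D             ≡⟨ cong _/D (x≡[x-g]+g (r ℤ.+ e) (+ g)) ⟩
      (r ℤ.+ e ℤ.- + g ℤ.+ + g) /D ≡⟨ cong (λ x → (x ℤ.+ + g) /D) r+e-g≡nD ⟩
      (n ℤ.* + D ℤ.+ + g) /D   ≡⟨ n+½≡[nD+g]/D n ⟨
      n ℚ./ 1 + ½              ∎)

  close⇔ : ∀ e → ℚ.∣ α h k + e /D - α h k ∣ ℚ.≤ invg k ⇔ e ∈ window
  close⇔ e = ∣i∣≤2⇔i∈window ⇔-∘ mk⇔
    (λ close → ℤP.drop‿+≤+ (/-cancel-≤ D (subst₂ ℚ._≤_ distance≡ invg≡2/D close)))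
    (λ ∣e∣≤2 → subst₂ ℚ._≤_ (sym distance≡) (sym invg≡2/D) (/-mono-≤ D (ℤ.+≤+ ∣e∣≤2)))
    where
    distance≡ : ℚ.∣ α h k + e /D - α h k ∣ ≡ (+ ℤ.∣ e ∣) /D
    distance≡ = trans (cong ℚ.∣_∣ (xyx⁻¹≈y (α h k) (e /D))) (∣-∣-/ e D)

  inSet⇔∈targets : ℤG.gcd h (+ k) ≡ + 1 → ∀ m →
                   InSet h k m ⇔ m ∈ map (λ e → α h k + e /D) (offsets (gcd k 12) (h %ℕ 3))
  inSet⇔∈targets coprime m =
    mk⇔ (λ (halfInt , close) → to (Equivalence.to (halfInt⇔ m) halfInt) close)
        (λ m∈targets → from (∈-map⁻ target m∈targets))
    where
    target : ℤ → ℚ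
    target e = α h k + e /D
    targets : List ℚ
    targets = map target (offsets (gcd k 12) (h %ℕ 3))
    Close : ℚ → Set
    Close x = ℚ.∣ x - α h k ∣ ℚ.≤ invg k
    to : ∃[ e ] (HalfIntegral h k e × m ≡ target e) → Close m → m ∈ targets
    to (e , halfIntegral , m≡) close = subst (_∈ targets) (sym m≡)
      (∈-map⁺ target (Equivalence.to (halfIntegral⇔offsets {h} {k} coprime e∈window) halfIntegral))
      where
      e∈window : e ∈ window
      e∈window = Equivalence.to (close⇔ e) (subst Close m≡ close)
    from : ∃[ e ] (e ∈ offsets (gcd k 12) (h %ℕ 3) × m ≡ target e) → InSet h k m
    from (e , e∈offsets , m≡) =
      Equivalence.from (halfInt⇔ m)
        (e , Equivalence.from (halfIntegral⇔offsets {h} {k} coprime e∈window) e∈offsets , m≡) ,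
      subst Close (sym m≡) (Equivalence.from (close⇔ e) e∈window)
      where
      e∈window : e ∈ window
      e∈window = offsets⊆window (gcd k 12) (h %ℕ 3) e∈offsets

  α+0/D≡α : α h k + (+ 0) /D ≡ α h k
  α+0/D≡α = trans (cong (ℚ._+_ (α h k)) (*≡*⇒/≡/ {+ 0} {+ 0} {D} {1} refl)) (ℚP.+-identityʳ (α h k))

  α+2/D≡α+q : ∀ {q} → invg k ≡ q → α h k + (+ 2) /D ≡ α h k + q
  α+2/D≡α+q invg≡q = cong (ℚ._+_ (α h k)) (trans (sym invg≡2/D) invg≡q)

  α-2/D≡α-q : ∀ {q} → invg k ≡ q → α h k + (- + 2) /D ≡ α h k - q
  α-2/D≡α-q invg≡q = cong (ℚ._+_ (α h k))
    (trans (neg-distribˡ-/ (+ 2) D) (cong ℚ.-_ (trans (sym invg≡2/D) invg≡q)))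

  invg≡1/gcd[c,6] : ∀ {c} .{{_ : NonZero (gcd c 6)}} → gcd k 12 ≡ c → invg k ≡ (+ 1) ℚ./ gcd c 6
  invg≡1/gcd[c,6] refl = ℚP./-cong {+ 1} {g} {+ 1} refl (sym (gcd-assoc k 12 6))

lemma3p4 : (k : ℕ) (h : ℤ) → k ≥ 1 → ℤG.gcd h (+ k) ≡ + 1 →
    (gcd k 12 ≡ 1 → ∀ m → InSet h k m ⇔ (m ≡ α h k ⊎ m ≡ α h k + 1ℚ ⊎ m ≡ α h k - 1ℚ))
    × (gcd k 12 ≡ 2 → ∀ m → InSet h k m ⇔ (m ≡ α h k + ½ ⊎ m ≡ α h k - ½))
    × (gcd k 12 ≡ 4 → ∀ m → InSet h k m ⇔ (m ≡ α h k))
    × ((gcd k 12 ≡ 3 ⊎ gcd k 12 ≡ 6) → h %ℕ 3 ≡ 1 → ∀ m → InSet h k m ⇔ (m ≡ α h k + invg k))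
    × ((gcd k 12 ≡ 3 ⊎ gcd k 12 ≡ 6) → h %ℕ 3 ≡ 2 → ∀ m → InSet h k m ⇔ (m ≡ α h k - invg k))
    × (gcd k 12 ≡ 12 → ∀ m → InSet h k m ⇔ ⊥)
lemma3p4 k h _ coprime =
  (λ c≡1 m → ∈[x,y,z]⇔ ⇔-∘ inSet⇔∈ (cong₂ offsets c≡1 refl)
    (α+0/D≡α ∷≡ α+2/D≡α+q (invg≡1/gcd[c,6] c≡1) ∷≡ α-2/D≡α-q (invg≡1/gcd[c,6] c≡1) ∷≡ refl) m) ,
  (λ c≡2 m → ∈[x,y]⇔ ⇔-∘ inSet⇔∈ (cong₂ offsets c≡2 refl)
    (α+2/D≡α+q (invg≡1/gcd[c,6] c≡2) ∷≡ α-2/D≡α-q (invg≡1/gcd[c,6] c≡2) ∷≡ refl) m) ,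
  (λ c≡4 m → ∈[x]⇔≡ ⇔-∘ inSet⇔∈ (cong₂ offsets c≡4 refl) (α+0/D≡α ∷≡ refl) m) ,
  (λ c≡3∨6 s≡1 m → ∈[x]⇔≡ ⇔-∘ inSet⇔∈ (offsets≡[3∨6] refl refl c≡3∨6 s≡1) (α+2/D≡α+q refl ∷≡ refl) m) ,
  (λ c≡3∨6 s≡2 m → ∈[x]⇔≡ ⇔-∘ inSet⇔∈ (offsets≡[3∨6] refl refl c≡3∨6 s≡2) (α-2/D≡α-q refl ∷≡ refl) m) ,
  (λ c≡12 m → ∈[]⇔⊥ ⇔-∘ inSet⇔∈ (cong₂ offsets c≡12 refl) refl m)
  where
  open Offset h k
  infixr 5 _∷≡_
  _∷≡_ : ∀ {x y : ℚ} {xs ys} → x ≡ y → xs ≡ ys → x ∷ xs ≡ y ∷ ys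
  _∷≡_ = cong₂ _∷_
  offsets≡[3∨6] : ∀ {s es} → offsets 3 s ≡ es → offsets 6 s ≡ es →
                  gcd k 12 ≡ 3 ⊎ gcd k 12 ≡ 6 → h %ℕ 3 ≡ s → offsets (gcd k 12) (h %ℕ 3) ≡ es
  offsets≡[3∨6] offsets₃≡ _ (inj₁ c≡3) s≡ = trans (cong₂ offsets c≡3 s≡) offsets₃≡
  offsets≡[3∨6] _ offsets₆≡ (inj₂ c≡6) s≡ = trans (cong₂ offsets c≡6 s≡) offsets₆≡
  inSet⇔∈ : ∀ {es ts} → offsets (gcd k 12) (h %ℕ 3) ≡ es → map (λ e → α h k + e /D) es ≡ ts →
            ∀ m → InSet h k m ⇔ m ∈ ts
  inSet⇔∈ refl refl = inSet⇔∈targets coprime
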